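{- Let $p$ be a prime, let $K$ be a field of characteristic $p$, and let $f\in K[x]$ be an additive polynomial of degree larger than $1$. Then for any $\gamma\in K$, the polynomial $f_1(x):=f(x)+\gamma$ is a conjugate of $f(x)$; that is, there exists a linear polynomial $\mu\in\overline{K}[x]$ such that $f_1=\mu^{ -1}\circ f\circ\mu$.
   Context: $\overline{K}$ denotes an algebraic closure of $K$. A polynomial $f\in K[x]$ is additive if $f(x+y)=f(x)+f(y)$ in $K[x,y]$. A conjugate of $f$ is any polynomial of the form $\mu^{ -1}\circ f\circ\mu$ with $\mu\in\overline{K}[x]$ linear (degree $1$). -}

module Defs where

open import Level using (Level; _⊔_; Lift; lift) renaming (suc to lsuc)
open import Data.Nat using (ℕ; zero; suc; _≤_)
open import Data.List using (List; []; _∷_; map; foldr)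
open import Data.Product using (_×_; ∃; Σ; _,_)
open import Data.Unit.Polymorphic using (⊤)
open import Relation.Nullary using (¬_)
open import Algebra.Bundles using (CommutativeRing)
open import Algebra.Bundles.Raw using (RawRing)
open import Algebra.Morphism.Structures using (module RingMorphisms)

-- Polynomials over a (raw) ring, represented by coefficient lists
-- [a₀, a₁, …, aₙ] meaning a₀ + a₁ x + … + aₙ xⁿ.
-- Equality is coefficientwise, padding with zeros (trailing zeros ignored).

module Poly {c ℓ} (R : RawRing c ℓ) where
  open RawRing R

  _≋_ : List Carrier → List Carrier → Set ℓ
  [] ≋ [] = ⊤
  [] ≋ (b ∷ bs) = (0# ≈ b) × ([] ≋ bs)
  (a ∷ as) ≋ [] = (a ≈ 0#) × (as ≋ [])
  (a ∷ as) ≋ (b ∷ bs) = (a ≈ b) × (as ≋ bs)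

  padd : List Carrier → List Carrier → List Carrier
  padd [] q = q
  padd (a ∷ p) [] = a ∷ p
  padd (a ∷ p) (b ∷ q) = (a + b) ∷ padd p q

  pscale : Carrier → List Carrier → List Carrier
  pscale a = map (a *_)

  pmul : List Carrier → List Carrier → List Carrier
  pmul [] q = []
  pmul (a ∷ p) q = padd (pscale a q) (0# ∷ pmul p q)

  pneg : List Carrier → List Carrier
  pneg = map -_

  const : Carrier → List Carrier
  const a = a ∷ []

  X : List Carrier
  X = 0# ∷ 1# ∷ []

  coeff : List Carrier → ℕ → Carrier
  coeff [] _ = 0#
  coeff (a ∷ _) zero = a
  coeff (_ ∷ p) (suc i) = coeff p i

  DegGreaterThan : ℕ → List Carrier → Set ℓ
  DegGreaterThan d p = ∃ λ i → (suc d ≤ i) × ¬ (coeff p i ≈ 0#)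

  NonZeroPoly : List Carrier → Set ℓ
  NonZeroPoly p = ∃ λ i → ¬ (coeff p i ≈ 0#)

polyRaw : ∀ {c ℓ} → RawRing c ℓ → RawRing c ℓ
polyRaw R = record
  { Carrier = List Carrier
  ; _≈_ = _≋_
  ; _+_ = padd
  ; _*_ = pmul
  ; -_ = pneg
  ; 0# = []
  ; 1# = const 1#
  }
  where open RawRing R ; open Poly R

evalAlong : ∀ {c ℓ c' ℓ'} (R : RawRing c ℓ) (S : RawRing c' ℓ') →
            (RawRing.Carrier R → RawRing.Carrier S) →
            List (RawRing.Carrier R) → RawRing.Carrier S → RawRing.Carrier S
evalAlong R S φ f s = foldr (λ a acc → φ a + s * acc) 0# f
  where open RawRing S

eval : ∀ {c ℓ} (R : RawRing c ℓ) → List (RawRing.Carrier R) → RawRing.Carrier R → RawRing.Carrier R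
eval R = evalAlong R R (λ a → a)

compose : ∀ {c ℓ} (R : RawRing c ℓ) → List (RawRing.Carrier R) → List (RawRing.Carrier R) → List (RawRing.Carrier R)
compose R g h = evalAlong R (polyRaw R) (Poly.const R) g h

record Field c ℓ : Set (lsuc (c ⊔ ℓ)) where
  field
    commutativeRing : CommutativeRing c ℓ
  open CommutativeRing commutativeRing public
  field
    0≉1     : ¬ (0# ≈ 1#)
    inverse : ∀ x → ¬ (x ≈ 0#) → ∃ λ y → (x * y) ≈ 1#

natCast : ∀ {c ℓ} (K : Field c ℓ) → ℕ → Field.Carrier K
natCast K zero = Field.0# K
natCast K (suc n) = Field._+_ K (Field.1# K) (natCast K n)

-- Additive polynomials:  f(x + y) = f(x) + f(y)  in K[x,y] = (K[x])[y].

module _ {c ℓ} (K : Field c ℓ) where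
  private
    R  = Field.rawRing K
    R1 = polyRaw R
    R2 = polyRaw R1
    ι : Field.Carrier K → RawRing.Carrier R2
    ι a = Poly.const R1 (Poly.const R a)
    vx vy : RawRing.Carrier R2
    vx = Poly.const R1 (Poly.X R)
    vy = Poly.X R1

  IsAdditive : List (Field.Carrier K) → Set ℓ
  IsAdditive f =
    RawRing._≈_ R2 (evalAlong R R2 ι f (RawRing._+_ R2 vx vy))
                   (RawRing._+_ R2 (evalAlong R R2 ι f vx) (evalAlong R R2 ι f vy))

IsFieldHom : ∀ {c ℓ c' ℓ'} (K : Field c ℓ) (L : Field c' ℓ') →
             (Field.Carrier K → Field.Carrier L) → Set (c ⊔ ℓ ⊔ ℓ')
IsFieldHom K L φ = RingMorphisms.IsRingHomomorphism (Field.rawRing K) (Field.rawRing L) φ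

IsAlgebraicallyClosed : ∀ {c' ℓ'} (L : Field c' ℓ') → Set (c' ⊔ ℓ')
IsAlgebraicallyClosed L =
  ∀ (g : List (Field.Carrier L)) → Poly.DegGreaterThan (Field.rawRing L) 0 g →
  ∃ λ r → Field._≈_ L (eval (Field.rawRing L) g r) (Field.0# L)

IsAlgebraicOver : ∀ {c ℓ c' ℓ'} (K : Field c ℓ) (L : Field c' ℓ') →
                  (Field.Carrier K → Field.Carrier L) → Set (c ⊔ ℓ ⊔ c' ⊔ ℓ')
IsAlgebraicOver K L φ =
  ∀ (z : Field.Carrier L) → ∃ λ (g : List (Field.Carrier K)) →
    Poly.NonZeroPoly (Field.rawRing K) g ×
    Field._≈_ L (evalAlong (Field.rawRing K) (Field.rawRing L) φ g z) (Field.0# L)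

record AlgebraicClosure {c ℓ} (K : Field c ℓ) (c' ℓ' : Level) : Set (lsuc (c' ⊔ ℓ') ⊔ c ⊔ ℓ) where
  field
    L         : Field c' ℓ'
    φ         : Field.Carrier K → Field.Carrier L
    isHom     : IsFieldHom K L φ
    algClosed : IsAlgebraicallyClosed L
    algebraic : IsAlgebraicOver K L φ

-- Conjugacy:  f₁ = μ⁻¹ ∘ f ∘ μ  for a linear μ = a x + b ∈ L[x] (a ≠ 0),
-- where μ⁻¹ is a polynomial that is a two-sided compositional inverse of μ.

module _ {c' ℓ'} (L : Field c' ℓ') where
  private
    R = Field.rawRing L

  IsConjugateVia : List (Field.Carrier L) → List (Field.Carrier L) → Set (c' ⊔ ℓ')
  IsConjugateVia f₁ f =
    ∃ λ a → ∃ λ b → ¬ (Field._≈_ L a (Field.0# L)) ×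
      (let μ = b ∷ a ∷ [] in
       ∃ λ (μ⁻¹ : List (Field.Carrier L)) →
         Poly._≋_ R (compose R μ⁻¹ μ) (Poly.X R) ×
         Poly._≋_ R (compose R μ μ⁻¹) (Poly.X R) ×
         Poly._≋_ R f₁ (compose R μ⁻¹ (compose R f μ)))

-- Let F be f with coefficients mapped into K̄, and pick b with F(b) = γ + b: a root of
-- F(x) − x − γ, which is nonconstant because deg F > 1. For μ = x + b and μ⁻¹ = x − b,
-- additivity gives μ⁻¹(F(x + b)) = F(x) + F(b) − b = F(x) + γ.
module Submission where

open import Defs
open import Level using (Level; _⊔_)
open import Data.Nat using (ℕ; zero; suc; s≤s; z≤n)
open import Data.Nat.Primality using (Prime)
open import Data.List using (List; []; _∷_; map)
open import Data.Product using (_,_; ∃; proj₁; proj₂)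
open import Data.Unit.Polymorphic using (tt)
open import Relation.Nullary using (¬_)
open import Relation.Binary.Bundles using (Setoid)
open import Relation.Binary.Structures using (IsEquivalence)
open import Relation.Binary.PropositionalEquality as ≡ using (_≡_)
open import Algebra.Bundles using (CommutativeRing)
open import Algebra.Bundles.Raw using (RawRing)
open import Algebra.Morphism.Structures using (module SemiringMorphisms; module RingMorphisms)
import Algebra.Morphism.Construct.Identity as Identity
import Algebra.Properties.CommutativeSemigroup as CommutativeSemigroupProperties
import Algebra.Properties.Ring as RingProperties
import Relation.Binary.Reasoning.Setoid as SetoidReasoning

module Polynomials {c ℓ} (R : CommutativeRing c ℓ) where
  open CommutativeRing R hiding (zero)
  open Poly rawRing public
  private
    module +-Comm = CommutativeSemigroupProperties +-commutativeSemigroup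

  -- _≋_ computes by recursion on both lists, so Agda cannot infer the lists from a proof of
  -- p ≋ q; this is why some steps below pass them as explicit implicit arguments.
  coeff-cong : ∀ {p q} → p ≋ q → ∀ i → coeff p i ≈ coeff q i
  coeff-cong {[]}    {[]}    _       i       = refl
  coeff-cong {[]}    {_ ∷ _} (e , _) zero    = e
  coeff-cong {[]}    {_ ∷ _} (_ , r) (suc i) = coeff-cong r i
  coeff-cong {_ ∷ _} {[]}    (e , _) zero    = e
  coeff-cong {_ ∷ _} {[]}    (_ , r) (suc i) = coeff-cong r i
  coeff-cong {_ ∷ _} {_ ∷ _} (e , _) zero    = e
  coeff-cong {_ ∷ _} {_ ∷ _} (_ , r) (suc i) = coeff-cong r i

  coeff-ext : ∀ {p q} → (∀ i → coeff p i ≈ coeff q i) → p ≋ q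
  coeff-ext {[]}    {[]}    h = tt
  coeff-ext {[]}    {_ ∷ _} h = h zero , coeff-ext (λ i → h (suc i))
  coeff-ext {_ ∷ _} {[]}    h = h zero , coeff-ext (λ i → h (suc i))
  coeff-ext {_ ∷ _} {_ ∷ _} h = h zero , coeff-ext (λ i → h (suc i))

  ≋-refl : ∀ {p} → p ≋ p
  ≋-refl = coeff-ext (λ i → refl)

  ≋-sym : ∀ {p q} → p ≋ q → q ≋ p
  ≋-sym e = coeff-ext (λ i → sym (coeff-cong e i))

  ≋-trans : ∀ {p q r} → p ≋ q → q ≋ r → p ≋ r
  ≋-trans e f = coeff-ext (λ i → trans (coeff-cong e i) (coeff-cong f i))

  ≋-isEquivalence : IsEquivalence _≋_
  ≋-isEquivalence = record { refl = ≋-refl ; sym = ≋-sym ; trans = ≋-trans }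

  ≋-setoid : Setoid c ℓ
  ≋-setoid = record { isEquivalence = ≋-isEquivalence }

  coeff-padd : ∀ p q i → coeff (padd p q) i ≈ coeff p i + coeff q i
  coeff-padd []      q       i       = sym (+-identityˡ _)
  coeff-padd (a ∷ p) []      i       = sym (+-identityʳ _)
  coeff-padd (a ∷ p) (b ∷ q) zero    = refl
  coeff-padd (a ∷ p) (b ∷ q) (suc i) = coeff-padd p q i

  coeff-pscale : ∀ a p i → coeff (pscale a p) i ≈ a * coeff p i
  coeff-pscale a []      i       = sym (zeroʳ a)
  coeff-pscale a (b ∷ p) zero    = refl
  coeff-pscale a (b ∷ p) (suc i) = coeff-pscale a p i

  coeff-pneg : ∀ p i → coeff (pneg p) i ≈ - coeff p i
  coeff-pneg []      i       = sym (RingProperties.-0#≈0# ring)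
  coeff-pneg (b ∷ p) zero    = refl
  coeff-pneg (b ∷ p) (suc i) = coeff-pneg p i

  padd-cong : ∀ {p p′ q q′} → p ≋ p′ → q ≋ q′ → padd p q ≋ padd p′ q′
  padd-cong {p} {p′} {q} {q′} e f = coeff-ext λ i → begin
    coeff (padd p q) i       ≈⟨ coeff-padd p q i ⟩
    coeff p i + coeff q i    ≈⟨ +-cong (coeff-cong e i) (coeff-cong f i) ⟩
    coeff p′ i + coeff q′ i  ≈⟨ coeff-padd p′ q′ i ⟨
    coeff (padd p′ q′) i     ∎
    where open SetoidReasoning setoid

  padd-comm : ∀ p q → padd p q ≋ padd q p
  padd-comm p q = coeff-ext λ i → begin
    coeff (padd p q) i     ≈⟨ coeff-padd p q i ⟩
    coeff p i + coeff q i  ≈⟨ +-comm _ _ ⟩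
    coeff q i + coeff p i  ≈⟨ coeff-padd q p i ⟨
    coeff (padd q p) i     ∎
    where open SetoidReasoning setoid

  padd-assoc : ∀ p q r → padd (padd p q) r ≋ padd p (padd q r)
  padd-assoc p q r = coeff-ext λ i → begin
    coeff (padd (padd p q) r) i
      ≈⟨ trans (coeff-padd (padd p q) r i) (+-congʳ (coeff-padd p q i)) ⟩
    (coeff p i + coeff q i) + coeff r i
      ≈⟨ +-assoc _ _ _ ⟩
    coeff p i + (coeff q i + coeff r i)
      ≈⟨ trans (coeff-padd p (padd q r) i) (+-congˡ (coeff-padd q r i)) ⟨
    coeff (padd p (padd q r)) i
      ∎
    where open SetoidReasoning setoid

  padd-identityʳ : ∀ p → padd p [] ≋ p
  padd-identityʳ p = coeff-ext λ i → trans (coeff-padd p [] i) (+-identityʳ _)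

  pneg-inverseˡ : ∀ p → padd (pneg p) p ≋ []
  pneg-inverseˡ p = coeff-ext λ i →
    trans (coeff-padd (pneg p) p i) (trans (+-congʳ (coeff-pneg p i)) (-‿inverseˡ _))

  pneg-inverseʳ : ∀ p → padd p (pneg p) ≋ []
  pneg-inverseʳ p = ≋-trans (padd-comm p (pneg p)) (pneg-inverseˡ p)

  pneg-cong : ∀ {p q} → p ≋ q → pneg p ≋ pneg q
  pneg-cong {p} {q} e = coeff-ext λ i →
    trans (coeff-pneg p i) (trans (-‿cong (coeff-cong e i)) (sym (coeff-pneg q i)))

  pscale-cong : ∀ {a b p q} → a ≈ b → p ≋ q → pscale a p ≋ pscale b q
  pscale-cong {a} {b} {p} {q} e f = coeff-ext λ i →
    trans (coeff-pscale a p i) (trans (*-cong e (coeff-cong f i)) (sym (coeff-pscale b q i)))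

  pscale-zeroˡ : ∀ p → pscale 0# p ≋ []
  pscale-zeroˡ p = coeff-ext λ i → trans (coeff-pscale 0# p i) (zeroˡ _)

  pscale-identityˡ : ∀ p → pscale 1# p ≋ p
  pscale-identityˡ p = coeff-ext λ i → trans (coeff-pscale 1# p i) (*-identityˡ _)

  pscale-distribˡ : ∀ a p q → pscale a (padd p q) ≋ padd (pscale a p) (pscale a q)
  pscale-distribˡ a p q = coeff-ext λ i → begin
    coeff (pscale a (padd p q)) i
      ≈⟨ trans (coeff-pscale a (padd p q) i) (*-congˡ (coeff-padd p q i)) ⟩
    a * (coeff p i + coeff q i)
      ≈⟨ distribˡ _ _ _ ⟩
    a * coeff p i + a * coeff q i
      ≈⟨ trans (coeff-padd (pscale a p) (pscale a q) i)
               (+-cong (coeff-pscale a p i) (coeff-pscale a q i)) ⟨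
    coeff (padd (pscale a p) (pscale a q)) i
      ∎
    where open SetoidReasoning setoid

  pscale-distribʳ : ∀ a b p → pscale (a + b) p ≋ padd (pscale a p) (pscale b p)
  pscale-distribʳ a b p = coeff-ext λ i → begin
    coeff (pscale (a + b) p) i
      ≈⟨ coeff-pscale (a + b) p i ⟩
    (a + b) * coeff p i
      ≈⟨ distribʳ _ _ _ ⟩
    a * coeff p i + b * coeff p i
      ≈⟨ trans (coeff-padd (pscale a p) (pscale b p) i)
               (+-cong (coeff-pscale a p i) (coeff-pscale b p i)) ⟨
    coeff (padd (pscale a p) (pscale b p)) i
      ∎
    where open SetoidReasoning setoid

  pscale-assoc : ∀ a b p → pscale (a * b) p ≋ pscale a (pscale b p)
  pscale-assoc a b p = coeff-ext λ i → begin
    coeff (pscale (a * b) p) i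
      ≈⟨ coeff-pscale (a * b) p i ⟩
    (a * b) * coeff p i
      ≈⟨ *-assoc _ _ _ ⟩
    a * (b * coeff p i)
      ≈⟨ trans (coeff-pscale a (pscale b p) i) (*-congˡ (coeff-pscale b p i)) ⟨
    coeff (pscale a (pscale b p)) i
      ∎
    where open SetoidReasoning setoid

  padd-swap : ∀ p q r → padd p (padd q r) ≋ padd q (padd p r)
  padd-swap p q r = coeff-ext λ i → begin
    coeff (padd p (padd q r)) i
      ≈⟨ trans (coeff-padd p (padd q r) i) (+-congˡ (coeff-padd q r i)) ⟩
    coeff p i + (coeff q i + coeff r i)
      ≈⟨ +-Comm.x∙yz≈y∙xz _ _ _ ⟩
    coeff q i + (coeff p i + coeff r i)
      ≈⟨ trans (coeff-padd q (padd p r) i) (+-congˡ (coeff-padd p r i)) ⟨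
    coeff (padd q (padd p r)) i
      ∎
    where open SetoidReasoning setoid

  padd-interchange : ∀ p q r s → padd (padd p q) (padd r s) ≋ padd (padd p r) (padd q s)
  padd-interchange p q r s = coeff-ext λ i → begin
    coeff (padd (padd p q) (padd r s)) i
      ≈⟨ trans (coeff-padd (padd p q) (padd r s) i)
               (+-cong (coeff-padd p q i) (coeff-padd r s i)) ⟩
    (coeff p i + coeff q i) + (coeff r i + coeff s i)
      ≈⟨ +-Comm.interchange _ _ _ _ ⟩
    (coeff p i + coeff r i) + (coeff q i + coeff s i)
      ≈⟨ trans (coeff-padd (padd p r) (padd q s) i)
               (+-cong (coeff-padd p r i) (coeff-padd q s i)) ⟨
    coeff (padd (padd p r) (padd q s)) i
      ∎
    where open SetoidReasoning setoid

  pmul-zeroʳ : ∀ p → pmul p [] ≋ []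
  pmul-zeroʳ []      = tt
  pmul-zeroʳ (a ∷ p) = refl , pmul-zeroʳ p

  pmul-≋[]ˡ : ∀ p q → p ≋ [] → pmul p q ≋ []
  pmul-≋[]ˡ []      q _             = tt
  pmul-≋[]ˡ (a ∷ p) q (a≈0 , p≋[]) = begin
    padd (pscale a q) (0# ∷ pmul p q)
      ≈⟨ padd-cong {q = 0# ∷ pmul p q} {0# ∷ []}
                   (pscale-cong {p = q} a≈0 ≋-refl) (refl , pmul-≋[]ˡ p q p≋[]) ⟩
    padd (pscale 0# q) (0# ∷ [])
      ≈⟨ padd-cong {q = 0# ∷ []} {0# ∷ []} (pscale-zeroˡ q) (≋-refl {0# ∷ []}) ⟩
    0# ∷ []
      ≈⟨ refl , tt ⟩
    []
      ∎
    where open SetoidReasoning ≋-setoid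

  pmul-congˡ : ∀ {p p′} q → p ≋ p′ → pmul p q ≋ pmul p′ q
  pmul-congˡ {[]}    {[]}     q _       = tt
  pmul-congˡ {[]}    {p′@(_ ∷ _)} q e = ≋-sym (pmul-≋[]ˡ p′ q (≋-sym {[]} {p′} e))
  pmul-congˡ {p@(_ ∷ _)} {[]} q e = pmul-≋[]ˡ p q e
  pmul-congˡ {_ ∷ _} {_ ∷ _}  q (e , r) =
    padd-cong {q = 0# ∷ _} {0# ∷ _} (pscale-cong {p = q} e ≋-refl) (refl , pmul-congˡ q r)

  pmul-congʳ : ∀ p {q q′} → q ≋ q′ → pmul p q ≋ pmul p q′
  pmul-congʳ []      e = tt
  pmul-congʳ (a ∷ p) e = padd-cong (pscale-cong refl e) (refl , pmul-congʳ p e)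

  pmul-cong : ∀ {p p′ q q′} → p ≋ p′ → q ≋ q′ → pmul p q ≋ pmul p′ q′
  pmul-cong {p′ = p′} {q = q} e f = ≋-trans (pmul-congˡ q e) (pmul-congʳ p′ f)

  pmul-consʳ : ∀ p b q → pmul p (b ∷ q) ≋ padd (pscale b p) (0# ∷ pmul p q)
  pmul-consʳ []      b q = refl , tt
  pmul-consʳ (a ∷ p) b q = +-congʳ (*-comm a b) , (begin
    padd (pscale a q) (pmul p (b ∷ q))
      ≈⟨ padd-cong ≋-refl (pmul-consʳ p b q) ⟩
    padd (pscale a q) (padd (pscale b p) (0# ∷ pmul p q))
      ≈⟨ padd-swap (pscale a q) (pscale b p) _ ⟩
    padd (pscale b p) (padd (pscale a q) (0# ∷ pmul p q))
      ∎)
    where open SetoidReasoning ≋-setoid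

  pmul-comm : ∀ p q → pmul p q ≋ pmul q p
  pmul-comm []      q = ≋-sym (pmul-zeroʳ q)
  pmul-comm (a ∷ p) q = begin
    padd (pscale a q) (0# ∷ pmul p q)
      ≈⟨ padd-cong {pscale a q} {q = 0# ∷ pmul p q} {0# ∷ pmul q p}
                   ≋-refl (refl , pmul-comm p q) ⟩
    padd (pscale a q) (0# ∷ pmul q p)
      ≈⟨ pmul-consʳ q a p ⟨
    pmul q (a ∷ p)
      ∎
    where open SetoidReasoning ≋-setoid

  pmul-distribʳ : ∀ r p q → pmul (padd p q) r ≋ padd (pmul p r) (pmul q r)
  pmul-distribʳ r []      q       = ≋-refl
  pmul-distribʳ r (a ∷ p) []      = ≋-sym (padd-identityʳ (pmul (a ∷ p) r))
  pmul-distribʳ r (a ∷ p) (b ∷ q) = begin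
    padd (pscale (a + b) r) (0# ∷ pmul (padd p q) r)
      ≈⟨ padd-cong (pscale-distribʳ a b r) (sym (+-identityʳ 0#) , pmul-distribʳ r p q) ⟩
    padd (padd (pscale a r) (pscale b r)) (padd (0# ∷ pmul p r) (0# ∷ pmul q r))
      ≈⟨ padd-interchange (pscale a r) (pscale b r) _ _ ⟩
    padd (pmul (a ∷ p) r) (pmul (b ∷ q) r)
      ∎
    where open SetoidReasoning ≋-setoid

  pmul-distribˡ : ∀ r p q → pmul r (padd p q) ≋ padd (pmul r p) (pmul r q)
  pmul-distribˡ r p q = begin
    pmul r (padd p q)              ≈⟨ pmul-comm r (padd p q) ⟩
    pmul (padd p q) r              ≈⟨ pmul-distribʳ r p q ⟩
    padd (pmul p r) (pmul q r)     ≈⟨ padd-cong (pmul-comm p r) (pmul-comm q r) ⟩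
    padd (pmul r p) (pmul r q)     ∎
    where open SetoidReasoning ≋-setoid

  pmul-pscaleˡ : ∀ a p q → pmul (pscale a p) q ≋ pscale a (pmul p q)
  pmul-pscaleˡ a []      q = tt
  pmul-pscaleˡ a (b ∷ p) q = begin
    padd (pscale (a * b) q) (0# ∷ pmul (pscale a p) q)
      ≈⟨ padd-cong (pscale-assoc a b q) (sym (zeroʳ a) , pmul-pscaleˡ a p q) ⟩
    padd (pscale a (pscale b q)) (pscale a (0# ∷ pmul p q))
      ≈⟨ pscale-distribˡ a (pscale b q) _ ⟨
    pscale a (pmul (b ∷ p) q)
      ∎
    where open SetoidReasoning ≋-setoid

  pmul-assoc : ∀ p q r → pmul (pmul p q) r ≋ pmul p (pmul q r)
  pmul-assoc []      q r = tt
  pmul-assoc (a ∷ p) q r = begin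
    pmul (padd (pscale a q) (0# ∷ pmul p q)) r
      ≈⟨ pmul-distribʳ r (pscale a q) _ ⟩
    padd (pmul (pscale a q) r) (pmul (0# ∷ pmul p q) r)
      ≈⟨ padd-cong (pmul-pscaleˡ a q r)
          (padd-cong {q = 0# ∷ pqr} {0# ∷ pqr} (pscale-zeroˡ r) (≋-refl {0# ∷ pqr})) ⟩
    padd (pscale a (pmul q r)) (0# ∷ pmul (pmul p q) r)
      ≈⟨ padd-cong {pscale a (pmul q r)} {q = 0# ∷ pqr} {0# ∷ pmul p (pmul q r)}
                   ≋-refl (refl , pmul-assoc p q r) ⟩
    pmul (a ∷ p) (pmul q r)
      ∎
    where
    open SetoidReasoning ≋-setoid
    pqr : List Carrier
    pqr = pmul (pmul p q) r

  pmul-identityˡ : ∀ p → pmul (const 1#) p ≋ p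
  pmul-identityˡ p = ≋-trans (padd-cong (pscale-identityˡ p) (refl , tt)) (padd-identityʳ p)

  pmul-identityʳ : ∀ p → pmul p (const 1#) ≋ p
  pmul-identityʳ p = ≋-trans (pmul-comm p (const 1#)) (pmul-identityˡ p)

  commutativeRing : CommutativeRing c ℓ
  commutativeRing = record
    { Carrier = List Carrier
    ; _≈_ = _≋_
    ; _+_ = padd
    ; _*_ = pmul
    ; -_ = pneg
    ; 0# = []
    ; 1# = const 1#
    ; isCommutativeRing = record
      { isRing = record
        { +-isAbelianGroup = record
          { isGroup = record
            { isMonoid = record
              { isSemigroup = record
                { isMagma = record { isEquivalence = ≋-isEquivalence ; ∙-cong = padd-cong }
                ; assoc = padd-assoc }
              ; identity = (λ p → ≋-refl) , padd-identityʳ }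
            ; inverse = pneg-inverseˡ , pneg-inverseʳ
            ; ⁻¹-cong = pneg-cong }
          ; comm = padd-comm }
        ; *-cong = pmul-cong
        ; *-assoc = pmul-assoc
        ; *-identity = pmul-identityˡ , pmul-identityʳ
        ; distrib = pmul-distribˡ , pmul-distribʳ }
      ; *-comm = pmul-comm }
    }

IsSemiringHom : ∀ {a ℓa b ℓb} (A : CommutativeRing a ℓa) (B : CommutativeRing b ℓb) →
                (CommutativeRing.Carrier A → CommutativeRing.Carrier B) → Set (a ⊔ ℓa ⊔ ℓb)
IsSemiringHom A B = SemiringMorphisms.IsSemiringHomomorphism
  (RawRing.rawSemiring (CommutativeRing.rawRing A)) (RawRing.rawSemiring (CommutativeRing.rawRing B))

module _ {a ℓa b ℓb} (A : CommutativeRing a ℓa) (B : CommutativeRing b ℓb) where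
  private
    module A = CommutativeRing A
    module B = CommutativeRing B

  mkIsSemiringHom : ∀ {ψ : A.Carrier → B.Carrier} →
    (∀ {x y} → x A.≈ y → ψ x B.≈ ψ y) →
    (∀ x y → ψ (x A.+ y) B.≈ ψ x B.+ ψ y) →
    (∀ x y → ψ (x A.* y) B.≈ ψ x B.* ψ y) →
    ψ A.0# B.≈ B.0# → ψ A.1# B.≈ B.1# → IsSemiringHom A B ψ
  mkIsSemiringHom cong +-homo *-homo 0#-homo 1#-homo = record
    { isNearSemiringHomomorphism = record
      { +-isMonoidHomomorphism = record
        { isMagmaHomomorphism = record { isRelHomomorphism = record { cong = cong } ; homo = +-homo }
        ; ε-homo = 0#-homo }
      ; *-homo = *-homo }
    ; 1#-homo = 1#-homo }

evalAlong-map : ∀ {a ℓa a′ ℓa′ b ℓb} (A : RawRing a ℓa) (A′ : RawRing a′ ℓa′) (B : RawRing b ℓb)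
  (ψ : RawRing.Carrier A′ → RawRing.Carrier B) (θ : RawRing.Carrier A → RawRing.Carrier A′) f s →
  evalAlong A′ B ψ (map θ f) s ≡ evalAlong A B (λ x → ψ (θ x)) f s
evalAlong-map A A′ B ψ θ []      s = ≡.refl
evalAlong-map A A′ B ψ θ (x ∷ f) s = ≡.cong (λ t → ψ (θ x) + s * t) (evalAlong-map A A′ B ψ θ f s)
  where open RawRing B

module Evaluation {a ℓa b ℓb} (A : CommutativeRing a ℓa) (B : CommutativeRing b ℓb) where
  private
    module A = CommutativeRing A
    module A[x] = Polynomials A
  open CommutativeRing B hiding (zero)
  open SetoidReasoning setoid
  private
    module +-Comm = CommutativeSemigroupProperties +-commutativeSemigroup
    module *-Comm = CommutativeSemigroupProperties *-commutativeSemigroup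

    ev : (A.Carrier → Carrier) → List A.Carrier → Carrier → Carrier
    ev = evalAlong A.rawRing rawRing

  evalAlong-congʳ : ∀ ψ f {s s′} → s ≈ s′ → ev ψ f s ≈ ev ψ f s′
  evalAlong-congʳ ψ []      e = refl
  evalAlong-congʳ ψ (a ∷ f) e = +-congˡ (*-cong e (evalAlong-congʳ ψ f e))

  evalAlong-congˡ : ∀ {ψ ψ′} → (∀ x → ψ x ≈ ψ′ x) → ∀ f s → ev ψ f s ≈ ev ψ′ f s
  evalAlong-congˡ h []      s = refl
  evalAlong-congˡ h (a ∷ f) s = +-cong (h a) (*-congˡ (evalAlong-congˡ h f s))

  module _ {ψ} (ψ-hom : IsSemiringHom A B ψ) (s : Carrier) where
    open SemiringMorphisms.IsSemiringHomomorphism ψ-hom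

    evalAt : List A.Carrier → Carrier
    evalAt p = ev ψ p s

    evalAt-≋[] : ∀ p → p A[x].≋ [] → evalAt p ≈ 0#
    evalAt-≋[] []      _       = refl
    evalAt-≋[] (a ∷ p) (e , r) = begin
      ψ a + s * evalAt p  ≈⟨ +-cong (trans (⟦⟧-cong e) 0#-homo) (*-congˡ (evalAt-≋[] p r)) ⟩
      0# + s * 0#         ≈⟨ +-identityˡ _ ⟩
      s * 0#              ≈⟨ zeroʳ s ⟩
      0#                  ∎

    evalAt-cong : ∀ {p q} → p A[x].≋ q → evalAt p ≈ evalAt q
    evalAt-cong {[]}        {[]}        e       = refl
    evalAt-cong {[]}        {q@(_ ∷ _)} e       = sym (evalAt-≋[] q (A[x].≋-sym {[]} {q} e))
    evalAt-cong {p@(_ ∷ _)} {[]}        e       = evalAt-≋[] p e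
    evalAt-cong {_ ∷ _}     {_ ∷ _}     (e , r) = +-cong (⟦⟧-cong e) (*-congˡ (evalAt-cong r))

    evalAt-+ : ∀ p q → evalAt (A[x].padd p q) ≈ evalAt p + evalAt q
    evalAt-+ []      q       = sym (+-identityˡ _)
    evalAt-+ (a ∷ p) []      = sym (+-identityʳ _)
    evalAt-+ (a ∷ p) (b ∷ q) = begin
      ψ (a A.+ b) + s * evalAt (A[x].padd p q)     ≈⟨ +-cong (+-homo a b) (*-congˡ (evalAt-+ p q)) ⟩
      (ψ a + ψ b) + s * (evalAt p + evalAt q)      ≈⟨ +-congˡ (distribˡ s _ _) ⟩
      (ψ a + ψ b) + (s * evalAt p + s * evalAt q)  ≈⟨ +-Comm.interchange _ _ _ _ ⟩
      (ψ a + s * evalAt p) + (ψ b + s * evalAt q)  ∎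

    evalAt-pscale : ∀ x q → evalAt (A[x].pscale x q) ≈ ψ x * evalAt q
    evalAt-pscale x []      = sym (zeroʳ _)
    evalAt-pscale x (b ∷ q) = begin
      ψ (x A.* b) + s * evalAt (A[x].pscale x q)
        ≈⟨ +-cong (*-homo x b) (*-congˡ (evalAt-pscale x q)) ⟩
      ψ x * ψ b + s * (ψ x * evalAt q)
        ≈⟨ +-congˡ (*-Comm.x∙yz≈y∙xz _ _ _) ⟩
      ψ x * ψ b + ψ x * (s * evalAt q)
        ≈⟨ distribˡ _ _ _ ⟨
      ψ x * (ψ b + s * evalAt q)
        ∎

    evalAt-* : ∀ p q → evalAt (A[x].pmul p q) ≈ evalAt p * evalAt q
    evalAt-* []      q = sym (zeroˡ _)
    evalAt-* (a ∷ p) q = begin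
      evalAt (A[x].padd (A[x].pscale a q) (A.0# ∷ A[x].pmul p q))
        ≈⟨ evalAt-+ (A[x].pscale a q) _ ⟩
      evalAt (A[x].pscale a q) + (ψ A.0# + s * evalAt (A[x].pmul p q))
        ≈⟨ +-cong (evalAt-pscale a q) (+-cong 0#-homo (*-congˡ (evalAt-* p q))) ⟩
      ψ a * evalAt q + (0# + s * (evalAt p * evalAt q))
        ≈⟨ +-congˡ (+-identityˡ _) ⟩
      ψ a * evalAt q + s * (evalAt p * evalAt q)
        ≈⟨ +-congˡ (*-assoc _ _ _) ⟨
      ψ a * evalAt q + (s * evalAt p) * evalAt q
        ≈⟨ distribʳ _ _ _ ⟨
      (ψ a + s * evalAt p) * evalAt q
        ∎

    evalAt-isSemiringHom : IsSemiringHom A[x].commutativeRing B evalAt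
    evalAt-isSemiringHom = mkIsSemiringHom A[x].commutativeRing B
      (λ {p} {q} → evalAt-cong {p} {q}) evalAt-+ evalAt-* refl
      (trans (+-cong 1#-homo (zeroʳ s)) (+-identityʳ _))

module _ {a ℓa b ℓb d ℓd}
         (A : CommutativeRing a ℓa) (B : CommutativeRing b ℓb) (C : CommutativeRing d ℓd) where
  private
    module A = CommutativeRing A
    module B = CommutativeRing B
  open CommutativeRing C

  evalAlong-natural : ∀ {θ} → IsSemiringHom B C θ → ∀ (ψ : A.Carrier → B.Carrier) f s →
    θ (evalAlong A.rawRing B.rawRing ψ f s) ≈ evalAlong A.rawRing rawRing (λ x → θ (ψ x)) f (θ s)
  evalAlong-natural θ-hom ψ []      s = 0#-homo
    where open SemiringMorphisms.IsSemiringHomomorphism θ-hom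
  evalAlong-natural θ-hom ψ (a ∷ f) s =
    trans (+-homo _ _) (+-congˡ (trans (*-homo _ _) (*-congˡ (evalAlong-natural θ-hom ψ f s))))
    where open SemiringMorphisms.IsSemiringHomomorphism θ-hom

module _ {a ℓa b ℓb} (A : CommutativeRing a ℓa) (B : CommutativeRing b ℓb)
         {ψ} (ψ-hom : IsSemiringHom A B ψ) where
  private
    module A = CommutativeRing A
    module A[x] = Polynomials A
    module B[x] = Polynomials B
  open CommutativeRing B hiding (zero)
  open SemiringMorphisms.IsSemiringHomomorphism ψ-hom
  open SetoidReasoning setoid

  coeff-map : ∀ p i → B[x].coeff (map ψ p) i ≈ ψ (A[x].coeff p i)
  coeff-map []      i       = sym 0#-homo
  coeff-map (x ∷ p) zero    = refl
  coeff-map (x ∷ p) (suc i) = coeff-map p i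

  map-cong : ∀ {p q} → p A[x].≋ q → map ψ p B[x].≋ map ψ q
  map-cong {p} {q} e = B[x].coeff-ext λ i → begin
    B[x].coeff (map ψ p) i  ≈⟨ coeff-map p i ⟩
    ψ (A[x].coeff p i)      ≈⟨ ⟦⟧-cong (A[x].coeff-cong e i) ⟩
    ψ (A[x].coeff q i)      ≈⟨ coeff-map q i ⟨
    B[x].coeff (map ψ q) i  ∎

  map-padd : ∀ p q → map ψ (A[x].padd p q) B[x].≋ B[x].padd (map ψ p) (map ψ q)
  map-padd p q = B[x].coeff-ext λ i → begin
    B[x].coeff (map ψ (A[x].padd p q)) i                 ≈⟨ coeff-map (A[x].padd p q) i ⟩
    ψ (A[x].coeff (A[x].padd p q) i)                     ≈⟨ ⟦⟧-cong (A[x].coeff-padd p q i) ⟩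
    ψ (A[x].coeff p i A.+ A[x].coeff q i)                ≈⟨ +-homo _ _ ⟩
    ψ (A[x].coeff p i) + ψ (A[x].coeff q i)              ≈⟨ +-cong (coeff-map p i) (coeff-map q i) ⟨
    B[x].coeff (map ψ p) i + B[x].coeff (map ψ q) i      ≈⟨ B[x].coeff-padd (map ψ p) (map ψ q) i ⟨
    B[x].coeff (B[x].padd (map ψ p) (map ψ q)) i         ∎

  map-pscale : ∀ x q → map ψ (A[x].pscale x q) B[x].≋ B[x].pscale (ψ x) (map ψ q)
  map-pscale x q = B[x].coeff-ext λ i → begin
    B[x].coeff (map ψ (A[x].pscale x q)) i     ≈⟨ coeff-map (A[x].pscale x q) i ⟩
    ψ (A[x].coeff (A[x].pscale x q) i)         ≈⟨ ⟦⟧-cong (A[x].coeff-pscale x q i) ⟩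
    ψ (x A.* A[x].coeff q i)                   ≈⟨ *-homo _ _ ⟩
    ψ x * ψ (A[x].coeff q i)                   ≈⟨ *-congˡ (coeff-map q i) ⟨
    ψ x * B[x].coeff (map ψ q) i               ≈⟨ B[x].coeff-pscale (ψ x) (map ψ q) i ⟨
    B[x].coeff (B[x].pscale (ψ x) (map ψ q)) i ∎

  map-pmul : ∀ p q → map ψ (A[x].pmul p q) B[x].≋ B[x].pmul (map ψ p) (map ψ q)
  map-pmul []      q = tt
  map-pmul (x ∷ p) q = B[x].≋-trans
    {q = B[x].padd (map ψ (A[x].pscale x q)) (ψ A.0# ∷ map ψ (A[x].pmul p q))}
    (map-padd (A[x].pscale x q) (A.0# ∷ A[x].pmul p q))
    (B[x].padd-cong {q = ψ A.0# ∷ _} {0# ∷ _} (map-pscale x q) (0#-homo , map-pmul p q))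

  map-isSemiringHom : IsSemiringHom A[x].commutativeRing B[x].commutativeRing (map ψ)
  map-isSemiringHom = mkIsSemiringHom A[x].commutativeRing B[x].commutativeRing
    (λ {p} {q} → map-cong {p} {q}) map-padd map-pmul tt (1#-homo , tt)

module Composition {a ℓa} (A : CommutativeRing a ℓa) where
  open CommutativeRing A hiding (zero)
  open Polynomials A
  open SetoidReasoning ≋-setoid

  const-isSemiringHom : IsSemiringHom A commutativeRing const
  const-isSemiringHom = mkIsSemiringHom A commutativeRing (λ e → e , tt) (λ _ _ → refl , tt)
    (λ _ _ → sym (+-identityʳ _) , tt) (refl , tt) (refl , tt)

  compose-X : ∀ p → compose rawRing p X ≋ p
  compose-X []      = tt
  compose-X (x ∷ p) = begin
    padd (const x) (pmul X p∘X)
      ≈⟨ padd-cong {const x} {const x} {q′ = 0# ∷ p} (≋-refl {const x}) X*p∘X≋xp ⟩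
    padd (const x) (0# ∷ p)
      ≈⟨ +-identityʳ x , ≋-refl ⟩
    x ∷ p
      ∎
    where
    p∘X : List Carrier
    p∘X = compose rawRing p X
    X*p∘X≋xp : pmul X p∘X ≋ (0# ∷ p)
    X*p∘X≋xp = padd-cong {q = 0# ∷ pmul (const 1#) p∘X} {0# ∷ p} (pscale-zeroˡ p∘X)
                 (refl , ≋-trans (pmul-identityˡ p∘X) (compose-X p))

  translation : Carrier → List Carrier
  translation c = c ∷ 1# ∷ []

  compose-congʳ : ∀ p h h′ → h ≋ h′ → compose rawRing p h ≋ compose rawRing p h′
  compose-congʳ p h h′ = Evaluation.evalAlong-congʳ A commutativeRing const p {h} {h′}

  compose-translation : ∀ c h → compose rawRing (translation c) h ≋ padd (const c) h
  compose-translation c h = padd-cong {const c} {const c} (≋-refl {const c}) (begin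
    pmul h (padd (const 1#) (pmul h []))
      ≈⟨ pmul-congʳ h (padd-cong {const 1#} {const 1#} (≋-refl {const 1#}) (pmul-zeroʳ h)) ⟩
    pmul h (padd (const 1#) [])
      ≈⟨ pmul-identityʳ h ⟩
    h
      ∎)

  translation-cancel : ∀ {c d} → c + d ≈ 0# → compose rawRing (translation c) (translation d) ≋ X
  translation-cancel {c} {d} c+d≈0 = begin
    compose rawRing (translation c) (translation d)  ≈⟨ compose-translation c (translation d) ⟩
    translation (c + d)                              ≈⟨ c+d≈0 , refl , tt ⟩
    X                                                ∎

  compose-const : ∀ p b → compose rawRing p (const b) ≋ const (eval rawRing p b)
  compose-const p b = ≋-sym {const (eval rawRing p b)} {compose rawRing p (const b)}
    (evalAlong-natural A A commutativeRing const-isSemiringHom (λ x → x) p b)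

module _ {c ℓ c′ ℓ′} (K : Field c ℓ) (L : Field c′ ℓ′) {φ} (φ-hom : IsFieldHom K L φ) where
  private
    module K = Field K
    module L = Field L
    open RingMorphisms.IsRingHomomorphism φ-hom

  fieldHom-preserves-≉0 : ∀ {x} → ¬ x K.≈ K.0# → ¬ φ x L.≈ L.0#
  fieldHom-preserves-≉0 {x} x≉0 φx≈0 with K.inverse x x≉0
  ... | y , xy≈1 = L.0≉1 (begin
    L.0#           ≈⟨ L.zeroˡ (φ y) ⟨
    L.0# L.* φ y   ≈⟨ L.*-congʳ φx≈0 ⟨
    φ x L.* φ y    ≈⟨ *-homo x y ⟨
    φ (x K.* y)    ≈⟨ ⟦⟧-cong xy≈1 ⟩
    φ K.1#         ≈⟨ 1#-homo ⟩
    L.1#           ∎)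
    where open SetoidReasoning L.setoid

  map-DegGreaterThan : ∀ d f → Poly.DegGreaterThan K.rawRing d f →
                       Poly.DegGreaterThan L.rawRing d (map φ f)
  map-DegGreaterThan d f (i , d<i , fᵢ≉0) = i , d<i , λ φfᵢ≈0 →
    fieldHom-preserves-≉0 fᵢ≉0
      (L.trans (L.sym (coeff-map K.commutativeRing L.commutativeRing isSemiringHomomorphism f i)) φfᵢ≈0)

module _ {c ℓ} (L : Field c ℓ) where
  open Field L
  private
    module L[x] = Polynomials commutativeRing
    module L-Ring = RingProperties ring

  shifted-fixed-point : IsAlgebraicallyClosed L → ∀ F → Poly.DegGreaterThan rawRing 1 F →
    ∀ g → ∃ λ b → eval rawRing F b ≈ g + b
  shifted-fixed-point closed F (suc (suc j) , s≤s (s≤s _) , F₂₊ⱼ≉0) g = b , Fb≈g+b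
    where
    open SetoidReasoning setoid
    open Evaluation commutativeRing commutativeRing using (evalAt-+)

    -[x+g] : List Carrier
    -[x+g] = - g ∷ - 1# ∷ []

    G : List Carrier
    G = L[x].padd F -[x+g]

    G-nonconstant : Poly.DegGreaterThan rawRing 0 G
    G-nonconstant = suc (suc j) , s≤s z≤n , λ G₂₊ⱼ≈0 →
      F₂₊ⱼ≉0 (trans (sym (+-identityʳ _))
                     (trans (sym (L[x].coeff-padd F -[x+g] (suc (suc j)))) G₂₊ⱼ≈0))

    b : Carrier
    b = proj₁ (closed G G-nonconstant)

    eval-[x+g] : eval rawRing -[x+g] b ≈ - (g + b)
    eval-[x+g] = begin
      - g + b * (- 1# + b * 0#)  ≈⟨ +-congˡ (*-congˡ (trans (+-congˡ (zeroʳ b)) (+-identityʳ _))) ⟩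
      - g + b * - 1#             ≈⟨ +-congˡ (trans (*-comm b _) (L-Ring.-1*x≈-x b)) ⟩
      - g + - b                  ≈⟨ L-Ring.-‿+-comm g b ⟩
      - (g + b)                  ∎

    Fb≈g+b : eval rawRing F b ≈ g + b
    Fb≈g+b = L-Ring.x∙y⁻¹≈ε⇒x≈y _ _ (begin
      eval rawRing F b + - (g + b)
        ≈⟨ +-congˡ eval-[x+g] ⟨
      eval rawRing F b + eval rawRing -[x+g] b
        ≈⟨ evalAt-+ (Identity.isSemiringHomomorphism (RawRing.rawSemiring rawRing) refl) b F -[x+g] ⟨
      eval rawRing G b
        ≈⟨ proj₂ (closed G G-nonconstant) ⟩
      0#
        ∎)

module _ {c ℓ b ℓb} (K : Field c ℓ) (L : CommutativeRing b ℓb)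
         {φ} (φ-hom : IsSemiringHom (Field.commutativeRing K) L φ) where
  private
    module K = Field K
    module K[x] = Polynomials K.commutativeRing
    module K[x,y] = Polynomials K[x].commutativeRing
    module L[x] = Polynomials L
    module φ = SemiringMorphisms.IsSemiringHomomorphism φ-hom
    open CommutativeRing L
    open Composition L

  -- Additivity is an identity in K[x,y]; substituting y ↦ b (and applying φ to the coefficients)
  -- transfers it to L[x].
  additive-compose-translation : ∀ {f} → IsAdditive K f → ∀ b →
    compose rawRing (map φ f) (translation b) L[x].≋
      L[x].padd (map φ f) (L[x].const (eval rawRing (map φ f) b))
  additive-compose-translation {f} additive b = begin
    compose rawRing F (translation b)
      ≈⟨ compose-congʳ F (translation b) (substitute x+y) translation≋substitute-x+y ⟩
    compose rawRing F (substitute x+y)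
      ≈⟨ substitute-f x+y ⟨
    substitute (f⟨ x+y ⟩)
      ≈⟨ ⟦⟧-cong additive ⟩
    substitute (K[x,y].padd f⟨ x ⟩ f⟨ y ⟩)
      ≈⟨ +-homo f⟨ x ⟩ f⟨ y ⟩ ⟩
    L[x].padd (substitute f⟨ x ⟩) (substitute f⟨ y ⟩)
      ≈⟨ L[x].padd-cong (substitute-f x) (substitute-f y) ⟩
    L[x].padd (compose rawRing F (substitute x)) (compose rawRing F (substitute y))
      ≈⟨ L[x].padd-cong (compose-congʳ F (substitute x) L[x].X substitute-x)
                        (compose-congʳ F (substitute y) (L[x].const b) substitute-y) ⟩
    L[x].padd (compose rawRing F L[x].X) (compose rawRing F (L[x].const b))
      ≈⟨ L[x].padd-cong (compose-X F) (compose-const F b) ⟩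
    L[x].padd F (L[x].const (eval rawRing F b))
      ∎
    where
    open SetoidReasoning L[x].≋-setoid
    F : List Carrier
    F = map φ f

    x y x+y : List (List K.Carrier)
    x = K[x,y].const K[x].X
    y = K[x,y].X
    x+y = K[x,y].padd x y

    ι : K.Carrier → List (List K.Carrier)
    ι a = K[x,y].const (K[x].const a)

    f⟨_⟩ : List (List K.Carrier) → List (List K.Carrier)
    f⟨ s ⟩ = evalAlong K.rawRing (polyRaw (polyRaw K.rawRing)) ι f s

    substitute : List (List K.Carrier) → List Carrier
    substitute = Evaluation.evalAt K[x].commutativeRing L[x].commutativeRing
      (map-isSemiringHom K.commutativeRing L φ-hom) (L[x].const b)

    substitute-hom : IsSemiringHom K[x,y].commutativeRing L[x].commutativeRing substitute
    substitute-hom = Evaluation.evalAt-isSemiringHom K[x].commutativeRing L[x].commutativeRing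
      (map-isSemiringHom K.commutativeRing L φ-hom) (L[x].const b)
    open SemiringMorphisms.IsSemiringHomomorphism substitute-hom

    substitute-f : ∀ s → substitute f⟨ s ⟩ L[x].≋ compose rawRing F (substitute s)
    substitute-f s = begin
      substitute f⟨ s ⟩
        ≈⟨ evalAlong-natural K.commutativeRing K[x,y].commutativeRing L[x].commutativeRing
             substitute-hom ι f s ⟩
      evalAlong K.rawRing (polyRaw rawRing) (λ a → substitute (ι a)) f (substitute s)
        ≈⟨ Evaluation.evalAlong-congˡ K.commutativeRing L[x].commutativeRing
             (λ a → +-identityʳ (φ a) , tt) f (substitute s) ⟩
      evalAlong K.rawRing (polyRaw rawRing) (λ a → L[x].const (φ a)) f (substitute s)
        ≡⟨ evalAlong-map K.rawRing rawRing (polyRaw rawRing) L[x].const φ f (substitute s) ⟨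
      compose rawRing F (substitute s)
        ∎

    substitute-x : substitute x L[x].≋ L[x].X
    substitute-x = trans (+-identityʳ _) φ.0#-homo , φ.1#-homo , tt

    substitute-y : substitute y L[x].≋ L[x].const b
    substitute-y =
      trans (+-identityʳ _) (trans (*-congˡ (trans (+-identityʳ _) φ.1#-homo)) (*-identityʳ b)) , tt

    translation≋substitute-x+y : translation b L[x].≋ substitute x+y
    translation≋substitute-x+y = begin
      translation b
        ≈⟨ +-identityˡ b , refl , tt ⟨
      L[x].padd L[x].X (L[x].const b)
        ≈⟨ L[x].padd-cong {substitute x} {L[x].X} {substitute y} {L[x].const b}
                          substitute-x substitute-y ⟨
      L[x].padd (substitute x) (substitute y)
        ≈⟨ +-homo x y ⟨
      substitute x+y
        ∎

module _ {c ℓ} (L : Field c ℓ) where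
  open Field L
  open Polynomials commutativeRing
    using (_≋_; padd; const; ≋-refl; ≋-setoid; padd-cong; padd-assoc; padd-comm)
  open Composition commutativeRing
  open SetoidReasoning ≋-setoid

  translation-conjugate : ∀ f₁ F b g → f₁ ≋ padd F (const g) →
    compose rawRing F (translation b) ≋ padd F (const (eval rawRing F b)) →
    eval rawRing F b ≈ g + b → IsConjugateVia L f₁ F
  translation-conjugate f₁ F b g f₁≋F+g F∘[x+b]≋F+Fb Fb≈g+b =
    1# , b , (λ 1≈0 → 0≉1 (sym 1≈0)) , translation (- b) ,
    translation-cancel (-‿inverseˡ b) , translation-cancel (-‿inverseʳ b) , (begin
      f₁
        ≈⟨ f₁≋F+g ⟩
      padd F (const g)
        ≈⟨ padd-cong {F} {F} {const g} ≋-refl (g≈Fb-b , tt) ⟩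
      padd F (padd (const Fb) (const (- b)))
        ≈⟨ padd-assoc F (const Fb) (const (- b)) ⟨
      padd (padd F (const Fb)) (const (- b))
        ≈⟨ padd-cong {q = const (- b)} {const (- b)} F∘[x+b]≋F+Fb (≋-refl {const (- b)}) ⟨
      padd (F∘[x+b]) (const (- b))
        ≈⟨ padd-comm F∘[x+b] (const (- b)) ⟩
      padd (const (- b)) F∘[x+b]
        ≈⟨ compose-translation (- b) F∘[x+b] ⟨
      compose rawRing (translation (- b)) F∘[x+b]
        ∎)
    where
    Fb : Carrier
    Fb = eval rawRing F b
    F∘[x+b] : List Carrier
    F∘[x+b] = compose rawRing F (translation b)
    g≈Fb-b : g ≈ Fb + - b
    g≈Fb-b = trans (sym (RingProperties.//-rightDividesʳ ring b g)) (+-congʳ (sym Fb≈g+b))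

lemma2p1 : ∀ {c ℓ} (c' ℓ' : Level) (p : ℕ) → Prime p →
    (K : Field c ℓ) → Field._≈_ K (natCast K p) (Field.0# K) →
    (f : List (Field.Carrier K)) → IsAdditive K f →
    Poly.DegGreaterThan (Field.rawRing K) 1 f →
    (γ : Field.Carrier K) →
    (Kbar : AlgebraicClosure K c' ℓ') →
    IsConjugateVia (AlgebraicClosure.L Kbar)
      (map (AlgebraicClosure.φ Kbar) (Poly.padd (Field.rawRing K) f (Poly.const (Field.rawRing K) γ)))
      (map (AlgebraicClosure.φ Kbar) f)
lemma2p1 c' ℓ' _ _ K _ f additive deg γ Kbar =
  translation-conjugate L _ F b (φ γ)
    (map-padd (Field.commutativeRing K) L-ring φ-hom f (Poly.const (Field.rawRing K) γ))
    (additive-compose-translation K L-ring φ-hom additive b)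
    (proj₂ fixed-point)
  where
  open AlgebraicClosure Kbar
  open Field L using (_≈_; _+_)

  L-ring : CommutativeRing c' ℓ'
  L-ring = Field.commutativeRing L

  φ-hom : IsSemiringHom (Field.commutativeRing K) L-ring φ
  φ-hom = RingMorphisms.IsRingHomomorphism.isSemiringHomomorphism isHom

  F : List (Field.Carrier L)
  F = map φ f

  fixed-point : ∃ λ b → eval (Field.rawRing L) F b ≈ φ γ + b
  fixed-point = shifted-fixed-point L algClosed F (map-DegGreaterThan K L isHom 1 f deg) (φ γ)

  b : Field.Carrier L
  b = proj₁ fixed-point
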